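{- Let $M\models T_{loc}$ and let $A$ be a subfield of the valued field $VF(M)$ which is closed under the map $i\circ\mathrm{res}$ (on elements of nonnegative valuation). Then $A$ and $k(M)$ are linearly disjoint over $k_A:=A\cap k(M)$.
   Context: $T_{loc}$ is the following theory in a three-sorted language with sorts $VF$ (valued field), $\Gamma$ (value group), $\mathrm{res}(VF)$ (residue field): the usual language of valued fields (valuation $\mathrm{val}:VF\to\Gamma\cup\{\infty\}$, residue map), a binary function $\mathrm{res}(\frac{x}{y})$ equal to $0$ if $\mathrm{val}(x)<\mathrm{val}(y)$ and otherwise to the residue of $x/y$, a distinguished element $1>0$ of $\Gamma$, and a function $i:\mathrm{res}(VF)\to VF$. $T_{loc}$ states that $VF$ is an algebraically closed field, $\mathrm{val}$ is a valuation with valuation ring $\mathcal{O}$ and maximal ideal $\mathcal{M}$, $i$ is a field embedding into $\mathcal{O}$ which is a section of the residue map, and, writing $k=i(\mathrm{res}(VF))$, $\mathcal{O}=\mathcal{M}\oplus k$. In a model $M$, $k(M)$ denotes this distinguished subfield. -}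

module Defs where

open import Level using (Level; _⊔_; Lift) renaming (suc to lsuc)
open import Algebra.Bundles using (CommutativeRing; AbelianGroup)
open import Data.Maybe using (Maybe; just; nothing)
open import Data.Product using (Σ; _×_; _,_)
open import Data.List using (List; []; _∷_; _∷ʳ_; foldr)
open import Data.Nat using (ℕ; zero; suc)
open import Data.Fin using (Fin; zero; suc)
open import Relation.Nullary using (¬_)
open import Data.Empty using (⊥)
open import Data.Unit using (⊤)
open import Relation.Binary using (Rel; IsTotalOrder)
open import Relation.Binary.PropositionalEquality using (_≡_)

record Field c ℓ : Set (lsuc (c ⊔ ℓ)) where
  field
    commutativeRing : CommutativeRing c ℓ
  open CommutativeRing commutativeRing public
  field
    1≉0     : ¬ (1# ≈ 0#)
    inverse : ∀ x → ¬ (x ≈ 0#) → Σ Carrier λ y → (x * y) ≈ 1#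

-- Totally ordered abelian groups (written additively via _∙_ / ε)

record OrderedAbelianGroup c ℓ₁ ℓ₂ : Set (lsuc (c ⊔ ℓ₁ ⊔ ℓ₂)) where
  field
    abelianGroup : AbelianGroup c ℓ₁
  open AbelianGroup abelianGroup public
  field
    _≤_          : Rel Carrier ℓ₂
    isTotalOrder : IsTotalOrder _≈_ _≤_
    ≤-compat     : ∀ {x y} z → x ≤ y → (x ∙ z) ≤ (y ∙ z)

  _<_ : Rel Carrier (ℓ₁ ⊔ ℓ₂)
  x < y = (x ≤ y) × ¬ (x ≈ y)

  -- Γ ∪ {∞}, with ∞ represented by nothing
  _≈∞_ : Rel (Maybe Carrier) ℓ₁
  just x  ≈∞ just y  = x ≈ y
  just x  ≈∞ nothing = Lift ℓ₁ ⊥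
  nothing ≈∞ just y  = Lift ℓ₁ ⊥
  nothing ≈∞ nothing = Lift ℓ₁ ⊤

  _≤∞_ : Rel (Maybe Carrier) ℓ₂
  just x  ≤∞ just y  = x ≤ y
  just x  ≤∞ nothing = Lift ℓ₂ ⊤
  nothing ≤∞ just y  = Lift ℓ₂ ⊥
  nothing ≤∞ nothing = Lift ℓ₂ ⊤

  _<∞_ : Rel (Maybe Carrier) (ℓ₁ ⊔ ℓ₂)
  x <∞ y = (x ≤∞ y) × ¬ (x ≈∞ y)

  _+∞_ : Maybe Carrier → Maybe Carrier → Maybe Carrier
  just x  +∞ just y = just (x ∙ y)
  just x  +∞ nothing = nothing
  nothing +∞ _       = nothing

-- Polynomial evaluation (coefficient list, constant term first)

module _ {c ℓ} (K : Field c ℓ) where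
  open Field K using (Carrier; _≈_; _+_; _*_; -_; 0#; 1#)

  eval : List Carrier → Carrier → Carrier
  eval cs x = foldr (λ a acc → a + (x * acc)) 0# cs

  -- every monic polynomial of degree ≥ 1 has a root
  AlgebraicallyClosed : Set (c ⊔ ℓ)
  AlgebraicallyClosed =
    ∀ (a : Carrier) (as : List Carrier) →
      Σ Carrier λ x → eval ((a ∷ as) ∷ʳ 1#) x ≈ 0#

  sumFin : (n : ℕ) → (Fin n → Carrier) → Carrier
  sumFin zero    f = 0#
  sumFin (suc n) f = f zero + sumFin n (λ j → f (suc j))

record TlocModel c ℓ ℓ' : Set (lsuc (c ⊔ ℓ ⊔ ℓ')) where
  field
    VF : Field c ℓ
    Γ  : OrderedAbelianGroup c ℓ ℓ'
    RF : Field c ℓ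
  module K = Field VF
  module G = OrderedAbelianGroup Γ
  module R = Field RF
  field
    val  : K.Carrier → Maybe G.Carrier
    res  : K.Carrier → R.Carrier         -- residue map (only its values on 𝒪 matter)
    one  : G.Carrier
    i    : R.Carrier → K.Carrier

  𝒪 : K.Carrier → Set ℓ'
  𝒪 x = just G.ε G.≤∞ val x

  𝓜 : K.Carrier → Set (ℓ ⊔ ℓ')
  𝓜 x = just G.ε G.<∞ val x

  field
    acf : AlgebraicallyClosed VF
    val-cong : ∀ {x y} → x K.≈ y → val x G.≈∞ val y
    val-∞⇒0  : ∀ {x} → val x ≡ nothing → x K.≈ K.0#
    val-0    : ∀ {x} → x K.≈ K.0# → val x ≡ nothing
    val-*    : ∀ x y → val (x K.* y) G.≈∞ (val x G.+∞ val y)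
    val-+    : ∀ x y γ → γ G.≤∞ val x → γ G.≤∞ val y → γ G.≤∞ val (x K.+ y)
    one-pos  : G.ε G.< one
    res-cong : ∀ {x y} → x K.≈ y → res x R.≈ res y
    res-+    : ∀ {x y} → 𝒪 x → 𝒪 y → res (x K.+ y) R.≈ (res x R.+ res y)
    res-*    : ∀ {x y} → 𝒪 x → 𝒪 y → res (x K.* y) R.≈ (res x R.* res y)
    res-1    : res K.1# R.≈ R.1#
    res-ker  : ∀ {x} → 𝒪 x → res x R.≈ R.0# → 𝓜 x
    res-ker′ : ∀ {x} → 𝓜 x → res x R.≈ R.0#
    i-cong   : ∀ {r s} → r R.≈ s → i r K.≈ i s
    i-+      : ∀ r s → i (r R.+ s) K.≈ (i r K.+ i s)
    i-*      : ∀ r s → i (r R.* s) K.≈ (i r K.* i s)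
    i-1      : i R.1# K.≈ K.1#
    i-inj    : ∀ {r s} → i r K.≈ i s → r R.≈ s
    i-𝒪      : ∀ r → 𝒪 (i r)
    i-section : ∀ r → res (i r) R.≈ r

  k : K.Carrier → Set (c ⊔ ℓ)
  k x = Σ R.Carrier λ r → x K.≈ i r

  field
    𝒪-sum    : ∀ {x} → 𝒪 x → Σ K.Carrier λ m → Σ R.Carrier λ r → 𝓜 m × x K.≈ (m K.+ i r)
    𝓜∩k      : ∀ {x} → 𝓜 x → k x → x K.≈ K.0#

module _ {c ℓ} (K : Field c ℓ) where
  open Field K using (Carrier; _≈_; _+_; _*_; -_; 0#; 1#)

  record IsSubfield {p} (A : Carrier → Set p) : Set (c ⊔ ℓ ⊔ p) where
    field
      A-cong : ∀ {x y} → x ≈ y → A x → A y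
      A-0    : A 0#
      A-1    : A 1#
      A-+    : ∀ {x y} → A x → A y → A (x + y)
      A-neg  : ∀ {x} → A x → A (- x)
      A-*    : ∀ {x y} → A x → A y → A (x * y)
      A-inv  : ∀ {x y} → A x → (x * y) ≈ 1# → A y

  LinearlyIndependentOver : ∀ {p} → (Carrier → Set p) → (n : ℕ) → (Fin n → Carrier) → Set (c ⊔ ℓ ⊔ p)
  LinearlyIndependentOver F n cs =
    ∀ (as : Fin n → Carrier) → (∀ j → F (as j)) →
      sumFin K n (λ j → as j * cs j) ≈ 0# → ∀ j → as j ≈ 0#

  LinearlyDisjointOver : ∀ {p q r} → (Carrier → Set p) → (Carrier → Set q) → (Carrier → Set r) → Set (c ⊔ ℓ ⊔ p ⊔ q ⊔ r)
  LinearlyDisjointOver E L F =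
    ∀ (n : ℕ) (cs : Fin n → Carrier) → (∀ j → L (cs j)) →
      LinearlyIndependentOver F n cs → LinearlyIndependentOver E n cs

-- Let Σ aₗ cₗ = 0 with aₗ ∈ A and cₗ ∈ k independent over A ∩ k, and pick a
-- coefficient aₘ of minimal valuation. If aₘ ≠ 0, dividing by it makes every
-- coefficient integral and the m-th one equal to 1. The map i ∘ res is a ring
-- homomorphism 𝒪 → k fixing k, and the closure hypothesis sends A ∩ 𝒪 into
-- A ∩ k; applying it gives a relation over A ∩ k whose m-th coefficient is 1,
-- contradicting independence. So aₘ = 0, i.e. the minimal valuation is ∞ and
-- every coefficient vanishes.

module Submission where

open import Defs
open import Level using (lift)
open import Data.Product using (Σ-syntax; _×_; _,_)
open import Data.Maybe using (Maybe; just; nothing)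
open import Data.Nat using (zero; suc)
open import Data.Fin using (Fin; zero; suc)
open import Data.Sum using (inj₁; inj₂)
open import Data.Empty using (⊥-elim)
open import Function using (_∘_)
open import Relation.Nullary using (Dec; yes; no)
open import Relation.Binary using (Rel; IsTotalOrder; Reflexive; Transitive; Total)
open import Relation.Binary.PropositionalEquality as ≡ using (_≡_; _≢_)
import Algebra.Properties.AbelianGroup as AbelianGroupProperties
import Algebra.Properties.Ring as RingProperties
import Relation.Binary.Reasoning.Setoid as SetoidReasoning

module _ {a ℓ} {X : Set a} {_≤_ : Rel X ℓ}
  (≤-refl : Reflexive _≤_) (≤-trans : Transitive _≤_) (≤-total : Total _≤_) where

  argmin : ∀ {n} (f : Fin (suc n) → X) → Σ[ m ∈ Fin (suc n) ] (∀ l → f m ≤ f l)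
  argmin {zero}  f = zero , λ { zero → ≤-refl }
  argmin {suc n} f with argmin (f ∘ suc)
  ... | m , m-min with ≤-total (f zero) (f (suc m))
  ...   | inj₁ f₀≤fₘ = zero , λ { zero → ≤-refl ; (suc l) → ≤-trans f₀≤fₘ (m-min l) }
  ...   | inj₂ fₘ≤f₀ = suc m , λ { zero → fₘ≤f₀ ; (suc l) → m-min l }

module ExtendedValueGroup {c ℓ₁ ℓ₂} (Γ : OrderedAbelianGroup c ℓ₁ ℓ₂) where
  open OrderedAbelianGroup Γ
  open IsTotalOrder isTotalOrder using (total)
    renaming (refl to ≤-refl; trans to ≤-trans; reflexive to ≤-reflexive)

  ≤∞-refl : ∀ x → x ≤∞ x
  ≤∞-refl (just x) = ≤-refl
  ≤∞-refl nothing  = lift _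

  ≤∞-trans : ∀ x y z → x ≤∞ y → y ≤∞ z → x ≤∞ z
  ≤∞-trans (just x) (just y) (just z) p q = ≤-trans p q
  ≤∞-trans (just x) _        nothing  p q = lift _
  ≤∞-trans (just x) nothing  (just z) p (lift ())
  ≤∞-trans nothing  (just y) _        (lift ()) q
  ≤∞-trans nothing  nothing  (just z) p (lift ())
  ≤∞-trans nothing  nothing  nothing  p q = lift _

  ≤∞-total : Total _≤∞_
  ≤∞-total (just x) (just y) = total x y
  ≤∞-total (just x) nothing  = inj₁ (lift _)
  ≤∞-total nothing  (just y) = inj₂ (lift _)
  ≤∞-total nothing  nothing  = inj₁ (lift _)

  ≈∞-sym : ∀ x y → x ≈∞ y → y ≈∞ x
  ≈∞-sym (just x) (just y)  e = sym e
  ≈∞-sym nothing  nothing   e = e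
  ≈∞-sym (just x) nothing   (lift ())
  ≈∞-sym nothing  (just y)  (lift ())

  ≈∞-trans : ∀ x y z → x ≈∞ y → y ≈∞ z → x ≈∞ z
  ≈∞-trans (just x) (just y) (just z) p q = trans p q
  ≈∞-trans nothing  nothing  nothing  p q = p
  ≈∞-trans (just x) (just y) nothing  p (lift ())
  ≈∞-trans (just x) nothing  _        (lift ()) q
  ≈∞-trans nothing  (just y) _        (lift ()) q
  ≈∞-trans nothing  nothing  (just z) p (lift ())

  ≤∞-respʳ-≈∞ : ∀ a x y → a ≤∞ x → x ≈∞ y → a ≤∞ y
  ≤∞-respʳ-≈∞ (just a) (just x) (just y) p e = ≤-trans p (≤-reflexive e)
  ≤∞-respʳ-≈∞ nothing  (just x) (just y) p e = p
  ≤∞-respʳ-≈∞ _        nothing  nothing  p e = p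
  ≤∞-respʳ-≈∞ _        (just x) nothing  p (lift ())
  ≤∞-respʳ-≈∞ _        nothing  (just y) p (lift ())

  argmin∞ : ∀ {n} (f : Fin (suc n) → Maybe Carrier) → Σ[ m ∈ Fin (suc n) ] (∀ l → f m ≤∞ f l)
  argmin∞ = argmin (λ {x} → ≤∞-refl x) (λ {x y z} → ≤∞-trans x y z) ≤∞-total

  ∞≤∞⇒≡∞ : ∀ {x} → nothing ≤∞ x → x ≡ nothing
  ∞≤∞⇒≡∞ {nothing} _ = ≡.refl
  ∞≤∞⇒≡∞ {just x}  (lift ())

  +∞-nonneg : ∀ x y → just ε ≤∞ x → just ε ≤∞ y → just ε ≤∞ (x +∞ y)
  +∞-nonneg (just x) (just y) p q = ≤-trans q (≤-trans (≤-reflexive (sym (identityˡ y))) (≤-compat y p))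
  +∞-nonneg (just x) nothing  p q = lift _
  +∞-nonneg nothing  _        p q = lift _

  +∞-inverse-≤ : ∀ u v w → (u +∞ v) ≈∞ just ε → u ≤∞ w → just ε ≤∞ (v +∞ w)
  +∞-inverse-≤ (just u) (just v) (just w) u+v≈ε u≤w =
    ≤-trans (≤-reflexive (sym u+v≈ε)) (≤-trans (≤-compat v u≤w) (≤-reflexive (comm w v)))
  +∞-inverse-≤ (just u) (just v) nothing  u+v≈ε u≤w = lift _
  +∞-inverse-≤ (just u) nothing  _        (lift ()) u≤w
  +∞-inverse-≤ nothing  _        _        (lift ()) u≤w

  idempotent⇒ε : ∀ {x} → x ≈ x ∙ x → x ≈ ε
  idempotent⇒ε {x} e = identityʳ-unique x x (sym e)
    where open AbelianGroupProperties abelianGroup using (identityʳ-unique)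

module FieldSums {c ℓ} (K : Field c ℓ) where
  open Field K hiding (zero)
  open SetoidReasoning setoid

  sumFin-cong : ∀ {n} {f g : Fin n → Carrier} → (∀ l → f l ≈ g l) → sumFin K n f ≈ sumFin K n g
  sumFin-cong {zero}  f≈g = refl
  sumFin-cong {suc n} f≈g = +-cong (f≈g zero) (sumFin-cong (f≈g ∘ suc))

  sumFin-*ˡ : ∀ {n} x (f : Fin n → Carrier) → sumFin K n (λ l → x * f l) ≈ x * sumFin K n f
  sumFin-*ˡ {zero}  x f = sym (zeroʳ x)
  sumFin-*ˡ {suc n} x f = begin
    x * f zero + sumFin K n (λ l → x * f (suc l)) ≈⟨ +-cong refl (sumFin-*ˡ x (f ∘ suc)) ⟩
    x * f zero + x * sumFin K n (f ∘ suc)         ≈⟨ distribˡ x (f zero) _ ⟨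
    x * sumFin K (suc n) f                        ∎

  relation-*ˡ : ∀ {n} x (a c : Fin n → Carrier) →
                sumFin K n (λ l → a l * c l) ≈ 0# → sumFin K n (λ l → (x * a l) * c l) ≈ 0#
  relation-*ˡ {n} x a c rel = begin
    sumFin K n (λ l → (x * a l) * c l) ≈⟨ sumFin-cong (λ l → *-assoc x (a l) (c l)) ⟩
    sumFin K n (λ l → x * (a l * c l)) ≈⟨ sumFin-*ˡ x (λ l → a l * c l) ⟩
    x * sumFin K n (λ l → a l * c l)   ≈⟨ *-cong refl rel ⟩
    x * 0#                             ≈⟨ zeroʳ x ⟩
    0#                                 ∎

module TlocProperties {c ℓ ℓ'} (M : TlocModel c ℓ ℓ') where
  open TlocModel M
  open ExtendedValueGroup Γ
  open FieldSums VF
  open SetoidReasoning K.setoid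

  ≈0? : ∀ x → Dec (x K.≈ K.0#)
  ≈0? x with val x in eq
  ... | nothing = yes (val-∞⇒0 eq)
  ... | just _  = no λ x≈0 → finite≢∞ (≡.trans (≡.sym eq) (val-0 x≈0))
    where
    finite≢∞ : ∀ {γ} → just γ ≢ nothing
    finite≢∞ ()

  ≈0-below : ∀ {x y} → x K.≈ K.0# → val x G.≤∞ val y → y K.≈ K.0#
  ≈0-below {y = y} x≈0 vx≤vy =
    val-∞⇒0 (∞≤∞⇒≡∞ (≡.subst (G._≤∞ val y) (val-0 x≈0) vx≤vy))

  val-1 : val K.1# G.≈∞ just G.ε
  val-1 with val K.1# in eq | val (K.1# K.* K.1#) | val-* K.1# K.1# | val-cong (K.*-identityˡ K.1#)
  ... | nothing | _       | _     | _   = ⊥-elim (K.1≉0 (val-∞⇒0 eq))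
  ... | just u  | just w  | w≈u+u | w≈u = idempotent⇒ε (G.trans (G.sym w≈u) w≈u+u)
  ... | just u  | nothing | lift () | _

  𝒪-0 : 𝒪 K.0#
  𝒪-0 = ≡.subst (just G.ε G.≤∞_) (≡.sym (val-0 K.refl)) (lift _)

  𝒪-cong : ∀ {x y} → x K.≈ y → 𝒪 x → 𝒪 y
  𝒪-cong {x} {y} x≈y 𝒪x = ≤∞-respʳ-≈∞ (just G.ε) (val x) (val y) 𝒪x (val-cong x≈y)

  𝒪-+ : ∀ {x y} → 𝒪 x → 𝒪 y → 𝒪 (x K.+ y)
  𝒪-+ {x} {y} = val-+ x y (just G.ε)

  𝒪-* : ∀ {x y} → 𝒪 x → 𝒪 y → 𝒪 (x K.* y)
  𝒪-* {x} {y} 𝒪x 𝒪y =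
    ≤∞-respʳ-≈∞ (just G.ε) (val x G.+∞ val y) (val (x K.* y))
      (+∞-nonneg (val x) (val y) 𝒪x 𝒪y) (≈∞-sym (val (x K.* y)) (val x G.+∞ val y) (val-* x y))

  𝒪-sumFin : ∀ {n} {f : Fin n → K.Carrier} → (∀ l → 𝒪 (f l)) → 𝒪 (sumFin VF n f)
  𝒪-sumFin {zero}  𝒪f = 𝒪-0
  𝒪-sumFin {suc n} 𝒪f = 𝒪-+ (𝒪f zero) (𝒪-sumFin (𝒪f ∘ suc))

  k⊆𝒪 : ∀ {x} → k x → 𝒪 x
  k⊆𝒪 (r , x≈ir) = 𝒪-cong (K.sym x≈ir) (i-𝒪 r)

  𝒪-div : ∀ {a b x} → a K.* b K.≈ K.1# → val a G.≤∞ val x → 𝒪 (b K.* x)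
  𝒪-div {a} {b} {x} ab≈1 va≤vx =
    ≤∞-respʳ-≈∞ (just G.ε) (val b G.+∞ val x) (val (b K.* x))
      (+∞-inverse-≤ (val a) (val b) (val x) va+vb≈0 va≤vx)
      (≈∞-sym (val (b K.* x)) (val b G.+∞ val x) (val-* b x))
    where
    va+vb≈0 : (val a G.+∞ val b) G.≈∞ just G.ε
    va+vb≈0 = ≈∞-trans (val a G.+∞ val b) (val (a K.* b)) (just G.ε)
                (≈∞-sym (val (a K.* b)) (val a G.+∞ val b) (val-* a b))
                (≈∞-trans (val (a K.* b)) (val K.1#) (just G.ε) (val-cong ab≈1) val-1)

  i∘res : K.Carrier → K.Carrier
  i∘res x = i (res x)

  i∘res-cong : ∀ {x y} → x K.≈ y → i∘res x K.≈ i∘res y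
  i∘res-cong = i-cong ∘ res-cong

  i∘res-+ : ∀ {x y} → 𝒪 x → 𝒪 y → i∘res (x K.+ y) K.≈ i∘res x K.+ i∘res y
  i∘res-+ 𝒪x 𝒪y = K.trans (i-cong (res-+ 𝒪x 𝒪y)) (i-+ _ _)

  i∘res-* : ∀ {x y} → 𝒪 x → 𝒪 y → i∘res (x K.* y) K.≈ i∘res x K.* i∘res y
  i∘res-* 𝒪x 𝒪y = K.trans (i-cong (res-* 𝒪x 𝒪y)) (i-* _ _)

  i∘res-1 : i∘res K.1# K.≈ K.1#
  i∘res-1 = K.trans (i-cong res-1) i-1

  i∘res-0 : i∘res K.0# K.≈ K.0#
  i∘res-0 = +-identityʳ-unique (i∘res K.0#) (i∘res K.0#) (begin
    i∘res K.0# K.+ i∘res K.0# ≈⟨ i∘res-+ 𝒪-0 𝒪-0 ⟨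
    i∘res (K.0# K.+ K.0#)     ≈⟨ i∘res-cong (K.+-identityʳ K.0#) ⟩
    i∘res K.0#                ∎)
    where open RingProperties K.ring using (+-identityʳ-unique)

  i∘res-fixes-k : ∀ {x} → k x → i∘res x K.≈ x
  i∘res-fixes-k {x} (r , x≈ir) = begin
    i∘res x      ≈⟨ i∘res-cong x≈ir ⟩
    i (res (i r)) ≈⟨ i-cong (i-section r) ⟩
    i r          ≈⟨ x≈ir ⟨
    x            ∎

  i∘res-sumFin : ∀ {n} {f : Fin n → K.Carrier} → (∀ l → 𝒪 (f l)) →
                 i∘res (sumFin VF n f) K.≈ sumFin VF n (i∘res ∘ f)
  i∘res-sumFin {zero}  𝒪f = i∘res-0
  i∘res-sumFin {suc n} 𝒪f = K.trans (i∘res-+ (𝒪f zero) (𝒪-sumFin (𝒪f ∘ suc)))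
                                    (K.+-cong K.refl (i∘res-sumFin (𝒪f ∘ suc)))

  i∘res-relation : ∀ {n} (a c : Fin n → K.Carrier) → (∀ l → 𝒪 (a l)) → (∀ l → k (c l)) →
                   sumFin VF n (λ l → a l K.* c l) K.≈ K.0# →
                   sumFin VF n (λ l → i∘res (a l) K.* c l) K.≈ K.0#
  i∘res-relation {n} a c 𝒪a kc rel = begin
    sumFin VF n (λ l → i∘res (a l) K.* c l)         ≈⟨ sumFin-cong (λ l → K.*-cong K.refl (i∘res-fixes-k (kc l))) ⟨
    sumFin VF n (λ l → i∘res (a l) K.* i∘res (c l)) ≈⟨ sumFin-cong (λ l → i∘res-* (𝒪a l) (k⊆𝒪 (kc l))) ⟨
    sumFin VF n (λ l → i∘res (a l K.* c l))         ≈⟨ i∘res-sumFin (λ l → 𝒪-* (𝒪a l) (k⊆𝒪 (kc l))) ⟨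
    i∘res (sumFin VF n (λ l → a l K.* c l))         ≈⟨ i∘res-cong rel ⟩
    i∘res K.0#                                      ≈⟨ i∘res-0 ⟩
    K.0#                                            ∎

module LinearDisjointness {c ℓ ℓ' p} (M : TlocModel c ℓ ℓ') (A : TlocModel.K.Carrier M → Set p)
  (A-subfield : IsSubfield (TlocModel.VF M) A)
  (A-closed : ∀ {x} → A x → TlocModel.𝒪 M x → A (TlocModel.i M (TlocModel.res M x)))
  {n} (c : Fin n → TlocModel.K.Carrier M) (kc : ∀ l → TlocModel.k M (c l))
  (c-independent : LinearlyIndependentOver (TlocModel.VF M) (λ x → A x × TlocModel.k M x) n c)
  where
  open TlocModel M
  open IsSubfield A-subfield
  open TlocProperties M
  open FieldSums VF
  open SetoidReasoning K.setoid

  IsRelation : (Fin n → K.Carrier) → Set ℓ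
  IsRelation a = sumFin VF n (λ l → a l K.* c l) K.≈ K.0#

  residues-vanish : ∀ a → (∀ l → A (a l)) → (∀ l → 𝒪 (a l)) → IsRelation a →
                    ∀ l → i∘res (a l) K.≈ K.0#
  residues-vanish a Aa 𝒪a rel =
    c-independent (i∘res ∘ a) (λ l → A-closed (Aa l) (𝒪a l) , res (a l) , K.refl)
      (i∘res-relation a c 𝒪a kc rel)

  minimal-coefficient-zero : ∀ a → (∀ l → A (a l)) → IsRelation a →
                             ∀ m → (∀ l → val (a m) G.≤∞ val (a l)) → a m K.≈ K.0#
  minimal-coefficient-zero a Aa rel m a-min with ≈0? (a m)
  ... | yes aₘ≈0 = aₘ≈0
  ... | no  aₘ≉0 with K.inverse (a m) aₘ≉0
  ...   | b , aₘb≈1 = ⊥-elim (K.1≉0 (begin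
    K.1#              ≈⟨ i∘res-1 ⟨
    i∘res K.1#        ≈⟨ i∘res-cong (K.trans (K.*-comm b (a m)) aₘb≈1) ⟨
    i∘res (b K.* a m) ≈⟨ residues-vanish (λ l → b K.* a l) (λ l → A-* (A-inv (Aa m) aₘb≈1) (Aa l))
                           (λ l → 𝒪-div aₘb≈1 (a-min l)) (relation-*ˡ b a c rel) m ⟩
    K.0#              ∎))

lemma6p1 : ∀ {c ℓ ℓ' p} (M : TlocModel c ℓ ℓ') (A : TlocModel.K.Carrier M → Set p) → IsSubfield (TlocModel.VF M) A → (∀ {x} → A x → TlocModel.𝒪 M x → A (TlocModel.i M (TlocModel.res M x))) → LinearlyDisjointOver (TlocModel.VF M) A (TlocModel.k M) (λ x → A x × TlocModel.k M x)
lemma6p1 M A A-subfield A-closed zero    c kc c-independent a Aa rel ()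
lemma6p1 M A A-subfield A-closed (suc n) c kc c-independent a Aa rel j
  with ExtendedValueGroup.argmin∞ (TlocModel.Γ M) (λ l → TlocModel.val M (a l))
... | m , a-min = TlocProperties.≈0-below M (minimal-coefficient-zero a Aa rel m a-min) (a-min j)
  where open LinearDisjointness M A A-subfield A-closed c kc c-independent
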